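{- Let $m,k\in\mathbb{N}$ with $1\le m<k$, and let $\ell=\lceil k/m\rceil$. Then $\mathtt{Error}_{m/k}\equiv_{LT}\mathtt{Error}_{1/\ell}$.
   Context: A bilayer function is a partial multi-valued function $g\colon\subseteq\mathbb{N}\times\Lambda\rightrightarrows\mathbb{N}$ for some set $\Lambda$; arguments are written $(n\mid c)$ ($n$ public input, $c$ secret input); $\mathrm{dom}_{\rm pub}(g)=\{n:\exists c\,(n\mid c)\in\mathrm{dom}(g)\}$. For $m<k$, $\mathtt{Error}_{m/k}$ is the bilayer function with public input always $\ast$, $\mathrm{dom}(\mathtt{Error}_{m/k})=\{(\ast\mid A):A\subseteq\{0,\dots,k-1\},|A|=m\}$ and $\mathtt{Error}_{m/k}(\ast\mid A)=\{0,\dots,k-1\}\setminus A$. LT-reducibility: for bilayer functions $f,g$, in the game $\mathfrak{G}(f,g)$ Merlin first plays $(x_0\mid c_0)\in\mathrm{dom}(f)$. At round $n$ Arthur plays $\langle j,u_n\rangle$: $j=0$ is a query $u_n\in\mathrm{dom}_{\rm pub}(g)$, $j=1$ declares termination with output $u_n$. After a query Nimue plays $z_n$ with $(u_n\mid z_n)\in\mathrm{dom}(g)$ and Merlin then plays $x_{n+1}\in g(u_n\mid z_n)$. Arthur sees only Merlin's public moves $x_0,x_1,\dots$ and uses a partial computable strategy; Merlin and Nimue see everything and use arbitrary strategies. Arthur and Nimue win if Merlin violates the rules first, or both obey and Arthur terminates with $u_n\in f(x_0\mid c_0)$. $f\le_{LT}g$ iff some Arthur–Nimue strategy wins against all Merlin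 strategies; $\equiv_{LT}$ is the induced equivalence. -}

module Defs where

open import Data.Nat using (ℕ; zero; suc; _+_; _<_)
open import Data.Nat.DivMod using (_/_)
open import Data.Fin using (fromℕ<)
open import Data.Fin.Subset using (Subset; _∉_; ∣_∣)
open import Data.List using (List; []; _∷_)
open import Data.Product using (Σ; Σ-syntax; _×_)
open import Relation.Binary.PropositionalEquality using (_≡_)

-- Ceiling division ⌈ k / m ⌉ (for m ≥ 1; value at m = 0 is irrelevant).
⌈_/_⌉ : ℕ → ℕ → ℕ
⌈ k / zero ⌉ = zero
⌈ k / suc m ⌉ = (k + m) / suc m

-- A bilayer function g :⊆ ℕ × Λ ⇉ ℕ.
--   Dom n c   : (n ∣ c) ∈ dom(g)
--   Val n c y : y ∈ g(n ∣ c)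
record Bilayer : Set₁ where
  field
    Λ   : Set
    Dom : ℕ → Λ → Set
    Val : ℕ → Λ → ℕ → Set

open Bilayer public

DomPub : (g : Bilayer) → ℕ → Set
DomPub g n = Σ[ c ∈ Λ g ] Dom g n c

-- The public input ∗ is encoded as 0.
∗ : ℕ
∗ = 0

Error : ℕ → ℕ → Bilayer
Error m k = record
  { Λ   = Subset k
  ; Dom = λ n A → (n ≡ ∗) × (∣ A ∣ ≡ m)
  ; Val = λ n A y → Σ[ p ∈ y < k ] (fromℕ< p ∉ A)
  }

-- Arthur's moves ⟨0,u⟩ (query u) and ⟨1,u⟩ (terminate with output u).
data AMove : Set where
  query : ℕ → AMove
  done  : ℕ → AMove

-- Arthur's strategy: a function of Merlin's public moves so far
-- (listed most recent first: xₙ ∷ … ∷ x₀ ∷ []).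
ArthurStrategy : Set
ArthurStrategy = List ℕ → AMove

-- Nimue sees everything; once Arthur's and Nimue's
-- strategies are fixed (deterministic), the whole history is determined by
-- Merlin's secret c₀ and Merlin's public moves x₀,…,xₙ, so it suffices to
-- let her move depend on these.
NimueStrategy : Bilayer → Bilayer → Set
NimueStrategy f g = Λ f → List ℕ → Λ g

-- Inductive: every legal
-- continuation by Merlin must lead, in finitely many rounds, to Arthur
-- terminating with a correct answer (Merlin playing an illegal move is a win,
-- hence only legal answers x ∈ g(u ∣ z) need to be considered; Arthur's query
-- must be in dom_pub(g), witnessed by Nimue's legal answer z).
data Win (f g : Bilayer) (α : ArthurStrategy) (ν : NimueStrategy f g)
         (x₀ : ℕ) (c₀ : Λ f) : List ℕ → Set where
  win-done  : ∀ {h u} → α h ≡ done u → Val f x₀ c₀ u → Win f g α ν x₀ c₀ h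
  win-query : ∀ {h u} → α h ≡ query u → Dom g u (ν c₀ h)
            → (∀ x → Val g u (ν c₀ h) x → Win f g α ν x₀ c₀ (x ∷ h))
            → Win f g α ν x₀ c₀ h

_≤LT_ : Bilayer → Bilayer → Set
f ≤LT g = Σ[ α ∈ ArthurStrategy ] Σ[ ν ∈ NimueStrategy f g ]
  (∀ x₀ c₀ → Dom f x₀ c₀ → Win f g α ν x₀ c₀ (x₀ ∷ []))

_≡LT_ : Bilayer → Bilayer → Set
f ≡LT g = (f ≤LT g) × (g ≤LT f)

-- Only (ℓ - 1) m < k ≤ ℓ m matters.  For Error m k ≤LT Error 1 ℓ, Arthur keeps the list of
-- m-subsets Merlin's secret may still be; while they cover all of Fin k there are at least
-- ℓ of them, and one query to Error 1 ℓ (Nimue's secret: which of the first ℓ is the true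
-- one) lets him discard a wrong one.  Once they no longer cover Fin k, any uncovered point
-- is a correct answer.  Conversely, Nimue hides Merlin's point b < ℓ in an m-subset around
-- the block [b m, b m + m) of Fin k, so every answer y outside it has y / m ≠ b.
module Submission where

open import Defs
open import Data.Nat using (ℕ; _≤_; _<_)
open import Data.Nat as ℕ using (zero; suc; _+_; _*_; _∸_; _⊓_; z≤n; s≤s; NonZero)
open import Data.Nat.Properties as ℕP using (module ≤-Reasoning)
open import Data.Nat.DivMod using (_/_; _%_; m≡m%n+[m/n]*n; m%n<n; m/n*n≤m; m<n*o⇒m/o<n)
open import Data.Nat.Induction using (<-wellFounded)
open import Data.Bool.Properties using () renaming (_≟_ to _≟ᵇ_)
open import Data.Fin using (Fin; toℕ; fromℕ<)
open import Data.Fin.Properties using (toℕ<n; toℕ-fromℕ<; fromℕ<-toℕ; fromℕ<-cong)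
open import Data.Fin.Subset
  using (Subset; inside; outside; _∈_; _∉_; _⊆_; ∣_∣; ⁅_⁆; _∪_; _-_; ∁; ⋃; Nonempty)
  renaming (⊥ to ∅; ⊤ to full)
open import Data.Fin.Subset.Properties
  using (nonempty?; ∣⊥∣≡0; ∣⊤∣≡n; ∣⁅x⁆∣≡1; x∈⁅x⁆; x∈∁p⇒x∉p; x∉∁p⇒x∈p; x∈p∪q⁺;
         p⊆q⇒∣p∣≤∣q∣; x∈p⇒∣p-x∣<∣p∣)
open import Data.Vec using ([]; _∷_; here; there)
open import Data.Vec.Properties using (≡-dec)
open import Data.List using (List; []; _∷_; length; map; _++_; filter)
open import Data.List.Membership.Propositional using () renaming (_∈_ to _∈ₗ_)
open import Data.List.Membership.Propositional.Properties
  using (∈-map⁺; ∈-++⁺ˡ; ∈-++⁺ʳ; ∈-filter⁺; ∈-filter⁻)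
open import Data.List.Relation.Unary.Any using () renaming (here to hereₗ; there to thereₗ)
open import Data.List.Relation.Unary.All as All using (All; []; _∷_)
open import Data.Product using (_,_; proj₂)
open import Data.Sum using (inj₁; inj₂)
open import Induction.WellFounded using (Acc; acc)
open import Relation.Nullary using (Dec; yes; no; ¬_)
open import Relation.Nullary.Negation using (contradiction)
open import Relation.Binary.Definitions using (DecidableEquality)
open import Relation.Binary.PropositionalEquality using (_≡_; _≢_; refl; sym; trans; cong; subst)

private variable
  A : Set
  n : ℕ

deleteAt : ℕ → List A → List A
deleteAt _ [] = []
deleteAt zero (_ ∷ xs) = xs
deleteAt (suc i) (x ∷ xs) = x ∷ deleteAt i xs

-- The first position of a in xs (junk value length xs if a ∉ xs).
indexOf : DecidableEquality A → A → List A → ℕ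
indexOf _≟_ a [] = 0
indexOf _≟_ a (x ∷ xs) with a ≟ x
... | yes _ = 0
... | no _ = suc (indexOf _≟_ a xs)

length-deleteAt : ∀ i (xs : List A) → i < length xs → length (deleteAt i xs) < length xs
length-deleteAt zero (x ∷ xs) _ = ℕP.n<1+n _
length-deleteAt (suc i) (x ∷ xs) (s≤s i<∣xs∣) = s≤s (length-deleteAt i xs i<∣xs∣)

All-deleteAt : ∀ {P : A → Set} i {xs} → All P xs → All P (deleteAt i xs)
All-deleteAt _ [] = []
All-deleteAt zero (_ ∷ pxs) = pxs
All-deleteAt (suc i) (px ∷ pxs) = px ∷ All-deleteAt i pxs

∈-deleteAt : (_≟_ : DecidableEquality A) {a : A} {xs : List A} (i : ℕ) →
             a ∈ₗ xs → i ≢ indexOf _≟_ a xs → a ∈ₗ deleteAt i xs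
∈-deleteAt _≟_ {a} {x ∷ xs} i a∈ i≢ with a ≟ x
∈-deleteAt _≟_ zero _ i≢ | yes _ = contradiction refl i≢
∈-deleteAt _≟_ (suc i) _ _ | yes a≡x = hereₗ a≡x
∈-deleteAt _≟_ i (hereₗ a≡x) _ | no a≢x = contradiction a≡x a≢x
∈-deleteAt _≟_ zero (thereₗ a∈) _ | no _ = a∈
∈-deleteAt _≟_ (suc i) (thereₗ a∈) i≢ | no _ = thereₗ (∈-deleteAt _≟_ i a∈ (λ e → i≢ (cong suc e)))

allSubsets : ∀ n → List (Subset n)
allSubsets zero = [] ∷ []
allSubsets (suc n) = map (inside ∷_) (allSubsets n) ++ map (outside ∷_) (allSubsets n)

∈-allSubsets : (p : Subset n) → p ∈ₗ allSubsets n
∈-allSubsets [] = hereₗ refl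
∈-allSubsets (inside ∷ p) = ∈-++⁺ˡ (∈-map⁺ (inside ∷_) (∈-allSubsets p))
∈-allSubsets {suc n} (outside ∷ p) =
  ∈-++⁺ʳ (map (inside ∷_) (allSubsets n)) (∈-map⁺ (outside ∷_) (∈-allSubsets p))

∣p∪q∣≤∣p∣+∣q∣ : (p q : Subset n) → ∣ p ∪ q ∣ ≤ ∣ p ∣ + ∣ q ∣
∣p∪q∣≤∣p∣+∣q∣ [] [] = z≤n
∣p∪q∣≤∣p∣+∣q∣ (inside ∷ p) (inside ∷ q) =
  s≤s (ℕP.≤-trans (∣p∪q∣≤∣p∣+∣q∣ p q) (ℕP.+-monoʳ-≤ ∣ p ∣ (ℕP.n≤1+n ∣ q ∣)))
∣p∪q∣≤∣p∣+∣q∣ (inside ∷ p) (outside ∷ q) = s≤s (∣p∪q∣≤∣p∣+∣q∣ p q)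
∣p∪q∣≤∣p∣+∣q∣ (outside ∷ p) (inside ∷ q) =
  subst (suc ∣ p ∪ q ∣ ≤_) (sym (ℕP.+-suc ∣ p ∣ ∣ q ∣)) (s≤s (∣p∪q∣≤∣p∣+∣q∣ p q))
∣p∪q∣≤∣p∣+∣q∣ (outside ∷ p) (outside ∷ q) = ∣p∪q∣≤∣p∣+∣q∣ p q

∣⋃ps∣≤∣ps∣*m : ∀ m (ps : List (Subset n)) → All (λ p → ∣ p ∣ ≡ m) ps → ∣ ⋃ ps ∣ ≤ length ps * m
∣⋃ps∣≤∣ps∣*m {n} m [] [] = ℕP.≤-reflexive (∣⊥∣≡0 n)
∣⋃ps∣≤∣ps∣*m m (p ∷ ps) (∣p∣≡m ∷ ∣ps∣≡m) = ℕP.≤-trans (∣p∪q∣≤∣p∣+∣q∣ p (⋃ ps))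
  (ℕP.+-mono-≤ (ℕP.≤-reflexive ∣p∣≡m) (∣⋃ps∣≤∣ps∣*m m ps ∣ps∣≡m))

⊆-⋃ : ∀ {p : Subset n} {ps} → p ∈ₗ ps → p ⊆ ⋃ ps
⊆-⋃ (hereₗ refl) x∈p = x∈p∪q⁺ (inj₁ x∈p)
⊆-⋃ (thereₗ p∈ps) x∈p = x∈p∪q⁺ (inj₂ (⊆-⋃ p∈ps x∈p))

-- The index of the least element of p (junk value n if p is empty).
least : Subset n → ℕ
least [] = 0
least (inside ∷ p) = 0
least (outside ∷ p) = suc (least p)

∣p∣≡1⇒toℕ≡least : ∀ {p : Subset n} {i} → ∣ p ∣ ≡ 1 → i ∈ p → toℕ i ≡ least p
∣p∣≡1⇒toℕ≡least {p = inside ∷ p} _ here = refl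
∣p∣≡1⇒toℕ≡least {p = inside ∷ p} ∣p∣≡1 (there i∈p) =
  contradiction (subst (∣ p - _ ∣ <_) (ℕP.suc-injective ∣p∣≡1) (x∈p⇒∣p-x∣<∣p∣ i∈p)) ℕP.n≮0
∣p∣≡1⇒toℕ≡least {p = outside ∷ p} ∣p∣≡1 (there i∈p) = cong suc (∣p∣≡1⇒toℕ≡least ∣p∣≡1 i∈p)

interval : ℕ → ℕ → (n : ℕ) → Subset n
interval _ _ zero = []
interval zero zero (suc n) = ∅
interval zero (suc c) (suc n) = inside ∷ interval zero c n
interval (suc s) c (suc n) = outside ∷ interval s c n

∣interval∣ : ∀ s c n → s + c ≤ n → ∣ interval s c n ∣ ≡ c
∣interval∣ s c zero s+c≤0 = sym (ℕP.n≤0⇒n≡0 (ℕP.m+n≤o⇒n≤o s s+c≤0))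
∣interval∣ zero zero (suc n) _ = ∣⊥∣≡0 (suc n)
∣interval∣ zero (suc c) (suc n) (s≤s c≤n) = cong suc (∣interval∣ zero c n c≤n)
∣interval∣ (suc s) c (suc n) (s≤s s+c≤n) = ∣interval∣ s c n s+c≤n

∈-interval : ∀ s c {n} (i : Fin n) → s ≤ toℕ i → toℕ i < s + c → i ∈ interval s c n
∈-interval zero (suc c) Fin.zero _ _ = here
∈-interval zero (suc c) (Fin.suc i) _ (s≤s i<c) = there (∈-interval zero c i z≤n i<c)
∈-interval (suc s) c (Fin.suc i) (s≤s s≤i) (s≤s i<s+c) = there (∈-interval s c i s≤i i<s+c)

_≟ₛ_ : DecidableEquality (Subset n)
_≟ₛ_ = ≡-dec _≟ᵇ_

module CandidateElimination (m k L' : ℕ) where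

  initialCandidates : List (Subset k)
  initialCandidates = filter (λ p → ∣ p ∣ ℕ.≟ m) (allSubsets k)

  candidates : List ℕ → List (Subset k)
  candidates (x ∷ h@(_ ∷ _)) = deleteAt x (candidates h)
  candidates _ = initialCandidates

  answer : {p : Subset k} → Dec (Nonempty p) → AMove
  answer (yes (y , _)) = done (toℕ y)
  answer (no _) = query ∗

  arthur : ArthurStrategy
  arthur h = answer (nonempty? (∁ (⋃ (candidates h))))

  -- Capped at L': if the secret sits further down the list, every answer is a wrong candidate.
  position : Subset k → List ℕ → Fin (suc L')
  position A h = fromℕ< (s≤s (ℕP.m⊓n≤n (indexOf _≟ₛ_ A (candidates h)) L'))

  nimue : NimueStrategy (Error m k) (Error 1 (suc L'))
  nimue A h = ⁅ position A h ⁆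

  ∉position⇒≢index : ∀ {x} A h (x<ℓ : x < suc L') →
                     fromℕ< x<ℓ ∉ ⁅ position A h ⁆ → x ≢ indexOf _≟ₛ_ A (candidates h)
  ∉position⇒≢index A h x<ℓ x∉ refl = x∉ (subst (_∈ ⁅ position A h ⁆)
    (fromℕ<-cong _ _ (ℕP.m≤n⇒m⊓n≡m (ℕ.s≤s⁻¹ x<ℓ)) _ _) (x∈⁅x⁆ (position A h)))

  initialCandidates-size : All (λ p → ∣ p ∣ ≡ m) initialCandidates
  initialCandidates-size = All.tabulate (λ p∈ → proj₂ (∈-filter⁻ (λ p → ∣ p ∣ ℕ.≟ m) {xs = allSubsets k} p∈))

  candidates-size : ∀ h → All (λ p → ∣ p ∣ ≡ m) (candidates h)
  candidates-size (x ∷ h@(_ ∷ _)) = All-deleteAt x (candidates-size h)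
  candidates-size (_ ∷ []) = initialCandidates-size
  candidates-size [] = initialCandidates-size

  module _ (L'm<k : L' * m < k) where

    covered⇒L'<length : ∀ h → ¬ Nonempty (∁ (⋃ (candidates h))) → L' < length (candidates h)
    covered⇒L'<length h uncovered = ℕP.*-cancelʳ-< m L' (length (candidates h)) (begin-strict
      L' * m                     <⟨ L'm<k ⟩
      k                          ≡⟨ sym (∣⊤∣≡n k) ⟩
      ∣ full {n = k} ∣           ≤⟨ p⊆q⇒∣p∣≤∣q∣ covers ⟩
      ∣ ⋃ (candidates h) ∣       ≤⟨ ∣⋃ps∣≤∣ps∣*m m (candidates h) (candidates-size h) ⟩
      length (candidates h) * m  ∎)
      where
      open ≤-Reasoning
      covers : full {n = k} ⊆ ⋃ (candidates h)
      covers _ = x∉∁p⇒x∈p (λ y∈∁ → uncovered (_ , y∈∁))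

    wins : ∀ x₀ A y h → A ∈ₗ candidates (y ∷ h) → Acc _<_ (length (candidates (y ∷ h))) →
           Win (Error m k) (Error 1 (suc L')) arthur nimue x₀ A (y ∷ h)
    wins x₀ A y h A∈ (acc shorter) with nonempty? (∁ (⋃ (candidates (y ∷ h)))) in eq
    ... | yes (z , z∈∁) = win-done (cong answer eq) (toℕ<n z , z∉A)
      where
      z∉A : fromℕ< (toℕ<n z) ∉ A
      z∉A z∈A = x∈∁p⇒x∉p z∈∁ (⊆-⋃ A∈ (subst (_∈ A) (fromℕ<-toℕ z (toℕ<n z)) z∈A))
    ... | no uncovered = win-query (cong answer eq) (refl , ∣⁅x⁆∣≡1 (position A (y ∷ h)))
      λ x (x<ℓ , x∉) → wins x₀ A x (y ∷ h)
        (∈-deleteAt _≟ₛ_ x A∈ (∉position⇒≢index A (y ∷ h) x<ℓ x∉))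
        (shorter (length-deleteAt x (candidates (y ∷ h))
          (ℕP.≤-<-trans (ℕ.s≤s⁻¹ x<ℓ) (covered⇒L'<length (y ∷ h) uncovered))))

    reduction : Error m k ≤LT Error 1 (suc L')
    reduction = arthur , nimue , λ x₀ A (_ , ∣A∣≡m) →
      wins x₀ A x₀ [] (∈-filter⁺ (λ p → ∣ p ∣ ℕ.≟ m) (∈-allSubsets A) ∣A∣≡m) (<-wellFounded _)

y<[y/m]*m+m : ∀ y m .{{_ : NonZero m}} → y < y / m * m + m
y<[y/m]*m+m y m = begin-strict
  y                     ≡⟨ m≡m%n+[m/n]*n y m ⟩
  y % m + y / m * m     <⟨ ℕP.+-monoˡ-< (y / m * m) (m%n<n y m) ⟩
  m + y / m * m         ≡⟨ ℕP.+-comm m (y / m * m) ⟩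
  y / m * m + m         ∎
  where open ≤-Reasoning

module BlockDecoding (m k ℓ : ℕ) .{{_ : NonZero m}} (m≤k : m ≤ k) (k≤ℓm : k ≤ ℓ * m) where

  -- The block of Merlin's point, pushed back so that it ends by k.
  blockStart : Subset ℓ → ℕ
  blockStart B = least B * m ⊓ (k ∸ m)

  arthur : ArthurStrategy
  arthur (y ∷ _ ∷ _) = done (y / m)
  arthur _ = query ∗

  nimue : NimueStrategy (Error 1 ℓ) (Error m k)
  nimue B _ = interval (blockStart B) m k

  blockStart+m≤k : ∀ B → blockStart B + m ≤ k
  blockStart+m≤k B = begin
    blockStart B + m  ≤⟨ ℕP.+-monoˡ-≤ m (ℕP.m⊓n≤n _ (k ∸ m)) ⟩
    k ∸ m + m         ≡⟨ ℕP.m∸n+n≡m m≤k ⟩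
    k                 ∎
    where open ≤-Reasoning

  ∈-block : ∀ B {y} (y<k : y < k) → y / m ≡ least B → fromℕ< y<k ∈ interval (blockStart B) m k
  ∈-block B {y} y<k y/m≡b = ∈-interval (blockStart B) m (fromℕ< y<k)
    (subst (blockStart B ≤_) (sym (toℕ-fromℕ< y<k)) start≤y)
    (subst (_< blockStart B + m) (sym (toℕ-fromℕ< y<k)) y<end)
    where
    open ≤-Reasoning
    start≤y : blockStart B ≤ y
    start≤y = begin
      blockStart B  ≤⟨ ℕP.m⊓n≤m _ (k ∸ m) ⟩
      least B * m   ≡⟨ cong (_* m) (sym y/m≡b) ⟩
      y / m * m     ≤⟨ m/n*n≤m y m ⟩
      y             ∎
    y<k∸m+m : y < k ∸ m + m
    y<k∸m+m = subst (y <_) (sym (ℕP.m∸n+n≡m m≤k)) y<k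
    y<end : y < blockStart B + m
    y<end = begin-strict
      y                              <⟨ ℕP.⊓-pres-m< (y<[y/m]*m+m y m) y<k∸m+m ⟩
      (y / m * m + m) ⊓ (k ∸ m + m)  ≡⟨ sym (ℕP.+-distribʳ-⊓ m (y / m * m) (k ∸ m)) ⟩
      y / m * m ⊓ (k ∸ m) + m        ≡⟨ cong (λ b → b * m ⊓ (k ∸ m) + m) y/m≡b ⟩
      blockStart B + m               ∎

  reduction : Error 1 ℓ ≤LT Error m k
  reduction = arthur , nimue , λ x₀ B (_ , ∣B∣≡1) →
    win-query refl (refl , ∣interval∣ (blockStart B) m k (blockStart+m≤k B)) λ y (y<k , y∉) →
      let y/m<ℓ = m<n*o⇒m/o<n (ℕP.<-≤-trans y<k k≤ℓm) in
      win-done refl (y/m<ℓ , λ y/m∈B →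
        y∉ (∈-block B y<k (trans (sym (toℕ-fromℕ< y/m<ℓ)) (∣p∣≡1⇒toℕ≡least ∣B∣≡1 y/m∈B))))

Error≡LTError1 : ∀ m k ℓ .{{_ : NonZero m}} →
                 m ≤ k → k ≤ ℓ * m → ℓ * m < k + m → Error m k ≡LT Error 1 ℓ
Error≡LTError1 m k zero m≤k k≤0 _ = contradiction (ℕP.≤-trans m≤k k≤0) (ℕP.<⇒≱ (ℕ.>-nonZero⁻¹ m))
Error≡LTError1 m k (suc L') m≤k k≤ℓm ℓm<k+m =
  CandidateElimination.reduction m k L' L'm<k , BlockDecoding.reduction m k (suc L') m≤k k≤ℓm
  where
  L'm<k : L' * m < k
  L'm<k = ℕP.+-cancelˡ-< m (L' * m) k (subst (m + L' * m <_) (ℕP.+-comm k m) ℓm<k+m)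

k≤⌈k/1+m⌉*[1+m] : ∀ k m → k ≤ ⌈ k / suc m ⌉ * suc m
k≤⌈k/1+m⌉*[1+m] k m = ℕP.+-cancelʳ-≤ m k (⌈ k / suc m ⌉ * suc m) (begin
  k + m                                     ≡⟨ m≡m%n+[m/n]*n (k + m) (suc m) ⟩
  (k + m) % suc m + ⌈ k / suc m ⌉ * suc m   ≤⟨ ℕP.+-monoˡ-≤ _ (ℕ.s≤s⁻¹ (m%n<n (k + m) (suc m))) ⟩
  m + ⌈ k / suc m ⌉ * suc m                 ≡⟨ ℕP.+-comm m _ ⟩
  ⌈ k / suc m ⌉ * suc m + m                 ∎)
  where open ≤-Reasoning

⌈k/1+m⌉*[1+m]<k+1+m : ∀ k m → ⌈ k / suc m ⌉ * suc m < k + suc m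
⌈k/1+m⌉*[1+m]<k+1+m k m = begin-strict
  ⌈ k / suc m ⌉ * suc m   ≤⟨ m/n*n≤m (k + m) (suc m) ⟩
  k + m                   <⟨ ℕP.+-monoʳ-< k (ℕP.n<1+n m) ⟩
  k + suc m               ∎
  where open ≤-Reasoning

mainTheorem2 : (m k : ℕ) → 1 ≤ m → m < k → Error m k ≡LT Error 1 ⌈ k / m ⌉
mainTheorem2 (suc m) k _ m<k =
  Error≡LTError1 (suc m) k ⌈ k / suc m ⌉ (ℕP.<⇒≤ m<k) (k≤⌈k/1+m⌉*[1+m] k m) (⌈k/1+m⌉*[1+m]<k+1+m k m)
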